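{- Let $g_4:\{\texttt{0},\texttt{1},\texttt{2}\}^*\to\{\texttt{0},\texttt{1}\}^*$ be the morphism $g_4(\texttt{0})=\texttt{00010011000111011}$, $g_4(\texttt{1})=\texttt{000100111011}$, $g_4(\texttt{2})=\texttt{00111}$. Every bi-infinite binary word whose only square factors are $\texttt{00}$, $\texttt{11}$, $\texttt{001001}$ and $\texttt{110110}$ has the same set of finite factors as $g_4(b_3)$.
   Context: $b_3$ is the Hall–Thue word, the fixed point starting with $\texttt{0}$ of the morphism $\texttt{0}\mapsto\texttt{012}$, $\texttt{1}\mapsto\texttt{02}$, $\texttt{2}\mapsto\texttt{1}$. A square is a nonempty word of the form $uu$. -}

module Defs where

open import Data.Nat using (ℕ; zero; suc)
open import Data.Integer using (ℤ; +_; _+_)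
open import Data.Fin using (Fin; zero; suc)
open import Data.List using (List; []; _∷_; _++_; length; concatMap; take; applyUpTo)
open import Data.Product using (Σ; ∃; _×_; _,_)
open import Data.Sum using (_⊎_)
open import Relation.Binary.PropositionalEquality using (_≡_; _≢_)

Word3 : Set
Word3 = List (Fin 3)

Word2 : Set
Word2 = List (Fin 2)

-- Hall–Thue morphism 0 ↦ 012, 1 ↦ 02, 2 ↦ 1
hallImg : Fin 3 → Word3
hallImg zero             = zero ∷ suc zero ∷ suc (suc zero) ∷ []
hallImg (suc zero)       = zero ∷ suc (suc zero) ∷ []
hallImg (suc (suc zero)) = suc zero ∷ []

hall : Word3 → Word3
hall = concatMap hallImg

-- hall^n(0); each is a prefix of b₃ (the fixed point starting with 0), of length ≥ n+1
hallIter : ℕ → Word3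
hallIter zero    = zero ∷ []
hallIter (suc n) = hall (hallIter n)

b₃-prefix : ℕ → Word3
b₃-prefix n = take n (hallIter n)

private
  O I : Fin 2
  O = zero
  I = suc zero

g₄Img : Fin 3 → Word2
g₄Img zero             = O ∷ O ∷ O ∷ I ∷ O ∷ O ∷ I ∷ I ∷ O ∷ O ∷ O ∷ I ∷ I ∷ I ∷ O ∷ I ∷ I ∷ []
g₄Img (suc zero)       = O ∷ O ∷ O ∷ I ∷ O ∷ O ∷ I ∷ I ∷ I ∷ O ∷ I ∷ I ∷ []
g₄Img (suc (suc zero)) = O ∷ O ∷ I ∷ I ∷ I ∷ []

g₄ : Word3 → Word2
g₄ = concatMap g₄Img

-- finite factors of the (one-sided) infinite word g₄(b₃):
-- u is a factor iff u occurs in g₄ of some finite prefix of b₃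
FactorOfG₄b₃ : Word2 → Set
FactorOfG₄b₃ u = ∃ λ n → ∃ λ (x : Word2) → ∃ λ (y : Word2) → g₄ (b₃-prefix n) ≡ x ++ u ++ y

BiWord : Set
BiWord = ℤ → Fin 2

slice : BiWord → ℤ → ℕ → Word2
slice w i zero    = []
slice w i (suc n) = w i ∷ slice w (i + + 1) n

FactorOf : BiWord → Word2 → Set
FactorOf w u = ∃ λ i → slice w i (length u) ≡ u

IsSquare : Word2 → Set
IsSquare u = ∃ λ (v : Word2) → v ≢ [] × u ≡ v ++ v

Allowed : Word2 → Set
Allowed u = u ≡ O ∷ O ∷ []
          ⊎ u ≡ I ∷ I ∷ []
          ⊎ u ≡ O ∷ O ∷ I ∷ O ∷ O ∷ I ∷ []
          ⊎ u ≡ I ∷ I ∷ O ∷ I ∷ I ∷ O ∷ []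

-- Call a binary word good if its only squares are 00, 11, 001001 and 110110, and a ternary word
-- good if it has no square, no 010 and no 212 between two letters. Both g₄ and the Hall–Thue
-- morphism can be undone on good words: a finite search shows that certain short words mark cut
-- points between images of letters, so a long good word is, up to boundedly many letters at its
-- ends, the image of a word, and that word is a good ternary word.
-- A factor u of w, taken with a long context on both sides, thus lies in the g₄-image of a good
-- ternary word with a long context. Desubstituting that word under the Hall–Thue morphism shrinks
-- it, until at length at most 10 a search finds it in b₃.
-- Conversely, desubstituting once shows by induction on k that every long enough good ternary
-- word contains hallIter k, so every long enough factor of w contains g₄ (hallIter k).

module Submission where

open import Defs
open import Data.Bool using (Bool; true; false; T; not; _∧_; _∨_)
open import Data.Bool.ListAction using (all; any)
open import Data.Bool.Properties using (T-≡; T-∧; T-∨; T-not-≡)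
open import Data.Empty using (⊥-elim)
open import Data.Fin using (Fin; zero; suc; toℕ)
open import Data.Fin.Properties using (toℕ-injective)
import Data.Integer as ℤ
import Data.Integer.Properties as ℤₚ
open import Data.List
  using (List; []; _∷_; _++_; [_]; length; take; drop; concatMap; null; allFin; _∷ʳ_; initLast; _∷ʳ′_)
open import Data.List.Membership.Propositional using (_∈_; find)
open import Data.List.Membership.Propositional.Properties using (∈-allFin)
open import Data.List.Properties
  using (++-assoc; ++-identityʳ; ++-monoid; ++-conicalˡ; ∷-injective; ∷-injectiveʳ; ∷ʳ-++; length-++; length-++-≤ˡ;
         length-take; length-drop; take++drop≡id; concatMap-++)
open import Data.List.Relation.Unary.All using (lookup)
open import Data.List.Relation.Unary.All.Properties using (all⁺)
open import Data.List.Relation.Unary.Any using (here; there)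
open import Data.List.Relation.Unary.Any.Properties using (any⁻)
open import Data.Nat using (ℕ; zero; suc; _+_; _*_; _∸_; _≤_; _<_; _≤?_; _<?_; _≡ᵇ_; ⌊_/2⌋; z≤n; s≤s)
open import Data.Nat.Induction using (<-wellFounded)
open import Data.Nat.Properties
  using (≤-refl; ≤-reflexive; ≤-trans; <⇒≤; <⇒≱; ≰⇒>; ≮⇒≥; ≤-pred; +-comm; m≤m+n; m≤n+m; +-mono-≤; +-monoˡ-≤;
         +-monoʳ-≤; +-monoʳ-<; *-monoʳ-≤; +-cancelʳ-≤; *-cancelˡ-≤; *-cancelˡ-<; *-suc; *-zeroʳ; *-identityˡ;
         suc-injective; m≤n⇒m⊓n≡m; m∸[m∸n]≡n; n≡⌊n+n/2⌋; ≡ᵇ⇒≡; ≡⇒≡ᵇ; m∸n≤m; m+[n∸m]≡n; m≢1+n+m;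
         module ≤-Reasoning)
open import Data.Nat.Tactic.RingSolver using (solve-∀)
open import Data.Product using (∃; ∃₂; _×_; _,_; proj₁; proj₂)
open import Data.Sum using (inj₁; inj₂)
open import Function using (_∘_; Equivalence)
open import Induction.WellFounded using (Acc; acc)
open import Relation.Binary.PropositionalEquality
  using (_≡_; _≢_; refl; sym; trans; cong; cong₂; subst; subst₂; module ≡-Reasoning)
open import Relation.Nullary using (¬_; yes; no)
open import Tactic.MonoidSolver using (solve)

private variable
  A : Set

pattern O  = zero
pattern I  = suc zero
pattern t₀ = zero
pattern t₁ = suc zero
pattern t₂ = suc (suc zero)

Factor : List A → List A → Set
Factor u z = ∃₂ λ x y → z ≡ x ++ u ++ y

factor-refl : (u : List A) → Factor u u
factor-refl u = [] , [] , sym (++-identityʳ u)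

factor-trans : {u v w : List A} → Factor u v → Factor v w → Factor u w
factor-trans {A} {u} (x , y , refl) (x′ , y′ , refl) = x′ ++ x , y ++ y′ , solve (++-monoid A)

factor-prefix : (x y : List A) → Factor x (x ++ y)
factor-prefix x y = [] , y , refl

factor-suffix : (x y : List A) → Factor y (x ++ y)
factor-suffix x y = x , [] , cong (x ++_) (sym (++-identityʳ y))

Square : List A → Set
Square u = ∃ λ v → v ≢ [] × u ≡ v ++ v

take-length-++ : (x y : List A) → take (length x) (x ++ y) ≡ x
take-length-++ []      y = refl
take-length-++ (a ∷ x) y = cong (a ∷_) (take-length-++ x y)

drop-length-++ : (x y : List A) → drop (length x) (x ++ y) ≡ y
drop-length-++ []      y = refl
drop-length-++ (a ∷ x) y = drop-length-++ x y

take-++ : ∀ n (u s : List A) → length u ≤ n → take n (u ++ s) ≡ u ++ take (n ∸ length u) s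
take-++ n       []      s _        = refl
take-++ (suc n) (a ∷ u) s (s≤s le) = cong (a ∷_) (take-++ n u s le)

length-++₃ : (x y z : List A) → length (x ++ y ++ z) ≡ length x + (length y + length z)
length-++₃ x y z = trans (length-++ x) (cong (length x +_) (length-++ y))

length-<-++ : (x : List A) {w : List A} → 1 ≤ length w → length x < length (x ++ w)
length-<-++ x {w} 1≤w = begin
  suc (length x)        ≡⟨ +-comm 1 (length x) ⟩
  length x + 1          ≤⟨ +-monoʳ-≤ (length x) 1≤w ⟩
  length x + length w   ≡⟨ sym (length-++ x) ⟩
  length (x ++ w)       ∎
  where open ≤-Reasoning

++-assoc₄ : (w x y z : List A) → (w ++ x ++ y) ++ z ≡ w ++ x ++ y ++ z
++-assoc₄ w x y z = trans (++-assoc w (x ++ y) z) (cong (w ++_) (++-assoc x y z))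

++-split : (x y w e : List A) → x ++ y ≡ w ++ e → length x ≤ length w →
           ∃ λ r → w ≡ x ++ r × y ≡ r ++ e
++-split []      y w       e eq _        = w , refl , eq
++-split (a ∷ x) y (b ∷ w) e eq (s≤s le) with ∷-injective eq
... | refl , eq′ with ++-split x y w e eq′ le
...   | r , refl , eq″ = r , refl , eq″

splitAtˡ : (z : List A) {n : ℕ} → n ≤ length z → ∃₂ λ z₁ z₂ → z ≡ z₁ ++ z₂ × length z₁ ≡ n
splitAtˡ z {n} n≤ = take n z , drop n z , sym (take++drop≡id n z) , trans (length-take n z) (m≤n⇒m⊓n≡m n≤)

splitAtʳ : (z : List A) {n : ℕ} → n ≤ length z → ∃₂ λ z₁ z₂ → z ≡ z₁ ++ z₂ × length z₂ ≡ n
splitAtʳ z {n} n≤ = take j z , drop j z , sym (take++drop≡id j z) , trans (length-drop j z) (m∸[m∸n]≡n n≤)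
  where j = length z ∸ n

any-sound : (p : A → Bool) (xs : List A) → T (any p xs) → ∃ λ x → x ∈ xs × T (p x)
any-sound p xs = find ∘ any⁻ p xs

all-lookup : (p : A → Bool) (xs : List A) → all p xs ≡ true → ∀ {x} → x ∈ xs → p x ≡ true
all-lookup p xs h x∈xs = Equivalence.to T-≡ (lookup (all⁺ p xs (Equivalence.from T-≡ h)) x∈xs)

anyPrefix : (List A → Bool) → List A → Bool
anyPrefix p []      = p []
anyPrefix p (a ∷ z) = p [] ∨ anyPrefix (p ∘ (a ∷_)) z

anyPrefix-sound : (p : List A → Bool) (z : List A) → T (anyPrefix p z) → ∃₂ λ v t → z ≡ v ++ t × T (p v)
anyPrefix-sound p []      h = [] , [] , refl , h
anyPrefix-sound p (a ∷ z) h with Equivalence.to T-∨ h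
... | inj₁ p[] = [] , a ∷ z , refl , p[]
... | inj₂ h′ with anyPrefix-sound (p ∘ (a ∷_)) z h′
...   | v , t , refl , pv = a ∷ v , t , refl , pv

anySuffix : (List A → Bool) → List A → Bool
anySuffix p []      = p []
anySuffix p (a ∷ z) = p (a ∷ z) ∨ anySuffix p z

anySuffix-sound : (p : List A → Bool) (z : List A) → T (anySuffix p z) → ∃₂ λ x v → z ≡ x ++ v × T (p v)
anySuffix-sound p []      h = [] , [] , refl , h
anySuffix-sound p (a ∷ z) h with Equivalence.to T-∨ h
... | inj₁ pz = [] , a ∷ z , refl , pz
... | inj₂ h′ with anySuffix-sound p z h′
...   | x , v , refl , pv = a ∷ x , v , refl , pv

anyFactor : (List A → Bool) → List A → Bool
anyFactor p = anySuffix (anyPrefix p)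

anyFactor-sound : (p : List A → Bool) (z : List A) → T (anyFactor p z) → ∃ λ v → Factor v z × T (p v)
anyFactor-sound p z h with anySuffix-sound (anyPrefix p) z h
... | x , w , refl , h′ with anyPrefix-sound p w h′
...   | v , y , refl , pv = v , (x , y , refl) , pv

module _ {n : ℕ} where

  infix 4 _==_ _isPrefixOfᵇ_ _isSuffixOfᵇ_

  _==_ : List (Fin n) → List (Fin n) → Bool
  []      == []      = true
  (a ∷ x) == (b ∷ y) = (toℕ a ≡ᵇ toℕ b) ∧ (x == y)
  _       == _       = false

  ==-sound : (x y : List (Fin n)) → T (x == y) → x ≡ y
  ==-sound []      []      _ = refl
  ==-sound (a ∷ x) (b ∷ y) h with Equivalence.to T-∧ h
  ... | a≡b , x≡y = cong₂ _∷_ (toℕ-injective (≡ᵇ⇒≡ _ _ a≡b)) (==-sound x y x≡y)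

  ==-refl : (x : List (Fin n)) → T (x == x)
  ==-refl []      = _
  ==-refl (a ∷ x) = Equivalence.from T-∧ (≡⇒≡ᵇ (toℕ a) (toℕ a) refl , ==-refl x)

  _isPrefixOfᵇ_ : List (Fin n) → List (Fin n) → Bool
  s isPrefixOfᵇ z = take (length s) z == s

  isPrefixOfᵇ-sound : (s z : List (Fin n)) → T (s isPrefixOfᵇ z) → ∃ λ t → z ≡ s ++ t
  isPrefixOfᵇ-sound s z h =
    drop (length s) z , trans (sym (take++drop≡id (length s) z)) (cong (_++ drop (length s) z) (==-sound _ s h))

  _isSuffixOfᵇ_ : List (Fin n) → List (Fin n) → Bool
  s isSuffixOfᵇ z = drop (length z ∸ length s) z == s

  isSuffixOfᵇ-sound : (s z : List (Fin n)) → T (s isSuffixOfᵇ z) → ∃ λ x → z ≡ x ++ s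
  isSuffixOfᵇ-sound s z h = take j z , trans (sym (take++drop≡id j z)) (cong (take j z ++_) (==-sound _ s h))
    where j = length z ∸ length s

  occursᵇ : List (Fin n) → List (Fin n) → Bool
  occursᵇ u = anySuffix (u isPrefixOfᵇ_)

  occursᵇ-sound : (u z : List (Fin n)) → T (occursᵇ u z) → Factor u z
  occursᵇ-sound u z h with anySuffix-sound (u isPrefixOfᵇ_) z h
  ... | x , v , refl , prefix with isPrefixOfᵇ-sound u v prefix
  ...   | y , refl = x , y , refl

  squareᵇ : List (Fin n) → Bool
  squareᵇ u = not (null u) ∧ (take h u == drop h u)
    where h = ⌊ length u /2⌋

  squareᵇ-sound : (u : List (Fin n)) → T (squareᵇ u) → Square u
  squareᵇ-sound u@(_ ∷ _) h = take j u , half≢[] , square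
    where
    j = ⌊ length u /2⌋
    square : u ≡ take j u ++ take j u
    square = trans (sym (take++drop≡id j u)) (cong (take j u ++_) (sym (==-sound _ _ h)))
    half≢[] : take j u ≢ []
    half≢[] e with trans square (cong (λ q → q ++ q) e)
    ... | ()

  squareᵇ-complete : (v : List (Fin n)) → v ≢ [] → T (squareᵇ (v ++ v))
  squareᵇ-complete []        v≢[] = ⊥-elim (v≢[] refl)
  squareᵇ-complete v@(_ ∷ _) _    =
    subst (λ j → T (take j (v ++ v) == drop j (v ++ v))) (sym half)
      (subst₂ (λ x y → T (x == y)) (sym (take-length-++ v v)) (sym (drop-length-++ v v)) (==-refl v))
    where
    half : ⌊ length (v ++ v) /2⌋ ≡ length v
    half = trans (cong ⌊_/2⌋ (length-++ v)) (sym (n≡⌊n+n/2⌋ (length v)))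

Avoids : (List A → Bool) → List A → Set
Avoids bad z = ∀ v → Factor v z → ¬ T (bad v)

module _ {bad : List A → Bool} where

  avoids-factor : {u z : List A} → Factor u z → Avoids bad z → Avoids bad u
  avoids-factor u⊑z g v v⊑u = g v (factor-trans v⊑u u⊑z)

  avoids-prefix : (x y : List A) → Avoids bad (x ++ y) → Avoids bad x
  avoids-prefix x y = avoids-factor (factor-prefix x y)

  avoids-suffix : (x y : List A) → Avoids bad (x ++ y) → Avoids bad y
  avoids-suffix x y = avoids-factor (factor-suffix x y)

  badPrefix⇒¬avoids : (z : List A) → T (anyPrefix bad z) → ¬ Avoids bad z
  badPrefix⇒¬avoids z h g with anyPrefix-sound bad z h
  ... | v , t , refl , bad-v = g v (factor-prefix v t) bad-v

  badFactor⇒¬avoids : (z : List A) → T (anyFactor bad z) → ¬ Avoids bad z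
  badFactor⇒¬avoids z h g with anyFactor-sound bad z h
  ... | v , v⊑z , bad-v = g v v⊑z bad-v

Unavoidable : (List A → Bool) → List A → Set
Unavoidable bad u = ∃ λ G → ∀ z → Avoids bad z → G ≤ length z → Factor u z

record Extendable (bad : List A → Bool) (c : ℕ) (u : List A) : Set where
  constructor extendable
  field
    left right : List A
    avoids     : Avoids bad (left ++ u ++ right)
    left-long  : c ≤ length left
    right-long : c ≤ length right

extendable-≤ : {bad : List A → Bool} {c c′ : ℕ} {u : List A} → c ≤ c′ → Extendable bad c′ u → Extendable bad c u
extendable-≤ c≤c′ (extendable p s g p-long s-long) = extendable p s g (≤-trans c≤c′ p-long) (≤-trans c≤c′ s-long)

module Search {n : ℕ} (bad : List (Fin n) → Bool) where

  -- Words are grown to the left, so only the factors starting at the new letter need testing.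
  everyExtension : List (Fin n) → (List (Fin n) → Bool) → ℕ → List (Fin n) → Bool
  everyExtension ctx done zero    c = done c
  everyExtension ctx done (suc ℓ) c = done c ∨
    all (λ a → anyPrefix bad (a ∷ c ++ ctx) ∨ everyExtension ctx done ℓ (a ∷ c)) (allFin n)

  everyExtension-sound : ∀ ctx done ℓ c → T (everyExtension ctx done ℓ c) →
    ∀ d → length d ≡ ℓ → Avoids bad (d ++ c ++ ctx) → ∃₂ λ d₁ d₂ → d ≡ d₁ ++ d₂ × T (done (d₂ ++ c))
  everyExtension-sound ctx done zero c h [] refl _ = [] , [] , refl , h
  everyExtension-sound ctx done (suc ℓ) c h d |d| g with Equivalence.to T-∨ h
  ... | inj₁ stop = d , [] , sym (++-identityʳ d) , stop
  ... | inj₂ h′ with initLast d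
  everyExtension-sound ctx done (suc ℓ) c h .[] () g | inj₂ h′ | []
  ... | d′ ∷ʳ′ a with everyExtension-sound ctx done ℓ (a ∷ c) extends d′ |d′| g′
    where
    g′ : Avoids bad (d′ ++ a ∷ c ++ ctx)
    g′ = subst (Avoids bad) (∷ʳ-++ d′ a (c ++ ctx)) g
    |d′| : length d′ ≡ ℓ
    |d′| = suc-injective (trans (trans (+-comm 1 (length d′)) (sym (length-++ d′))) |d|)
    extends : T (everyExtension ctx done ℓ (a ∷ c))
    extends with Equivalence.to T-∨ (lookup (all⁺ _ (allFin n) h′) (∈-allFin a))
    ... | inj₁ bad-prefix = ⊥-elim (badPrefix⇒¬avoids _ bad-prefix (avoids-suffix d′ (a ∷ c ++ ctx) g′))
    ... | inj₂ ok         = ok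
  ... | d₁ , d₂ , refl , ok = d₁ , d₂ ∷ʳ a , ++-assoc d₁ d₂ [ a ] , subst (T ∘ done) (sym (∷ʳ-++ d₂ a c)) ok

  everyWord : List (Fin n) → (List (Fin n) → Bool) → ℕ → Bool
  everyWord ctx done ℓ = everyExtension ctx done ℓ []

  everyWord-sound : ∀ ctx done ℓ → everyWord ctx done ℓ ≡ true →
    ∀ d → length d ≡ ℓ → Avoids bad (d ++ ctx) → ∃₂ λ d₁ d₂ → d ≡ d₁ ++ d₂ × T (done d₂)
  everyWord-sound ctx done ℓ h d |d| g with everyExtension-sound ctx done ℓ [] (Equivalence.from T-≡ h) d |d| g
  ... | d₁ , d₂ , eq , ok = d₁ , d₂ , eq , subst (T ∘ done) (++-identityʳ d₂) ok

  -- The length test keeps the search from stopping before the word is complete.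
  everyWordOfLength : (List (Fin n) → Bool) → ℕ → Bool
  everyWordOfLength leaf ℓ = everyWord [] (λ c → (length c ≡ᵇ ℓ) ∧ leaf c) ℓ

  everyWordOfLength-sound : ∀ leaf ℓ → everyWordOfLength leaf ℓ ≡ true →
    ∀ d → length d ≡ ℓ → Avoids bad d → T (leaf d)
  everyWordOfLength-sound leaf ℓ h d |d| g
    with everyWord-sound [] _ ℓ h d |d| (subst (Avoids bad) (sym (++-identityʳ d)) g)
  ... | [] , d₂ , refl , ok = proj₂ (Equivalence.to T-∧ ok)
  ... | a ∷ d₁ , d₂ , refl , ok = ⊥-elim (m≢1+n+m (length d₂) (begin
        length d₂                     ≡⟨ ≡ᵇ⇒≡ _ _ (proj₁ (Equivalence.to T-∧ ok)) ⟩
        ℓ                             ≡⟨ sym |d| ⟩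
        suc (length (d₁ ++ d₂))       ≡⟨ cong suc (length-++ d₁) ⟩
        suc (length d₁ + length d₂)   ∎))
    where open ≡-Reasoning

-- An occurrence of a word of S marks a cut between two σ-images: `parses` checks that such a cut
-- can always be moved one image to the left, `synchronises` that every word of length M has one.

endsWithImage : {m n : ℕ} → (Fin m → List (Fin n)) → List (List (Fin n)) → List (Fin n) → List (Fin n) → Bool
endsWithImage σ S ctx c = any (λ a → (σ a isSuffixOfᵇ c) ∧ any (_isPrefixOfᵇ (σ a ++ ctx)) S) (allFin _)

endsWithImage-sound : {m n : ℕ} (σ : Fin m → List (Fin n)) (S : List (List (Fin n))) (ctx c : List (Fin n)) →
  T (endsWithImage σ S ctx c) → ∃₂ λ a x → c ≡ x ++ σ a × ∃₂ λ s t → s ∈ S × σ a ++ ctx ≡ s ++ t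
endsWithImage-sound σ S ctx c h with any-sound _ (allFin _) h
... | a , _ , ok with Equivalence.to T-∧ ok
...   | suffix , synced with isSuffixOfᵇ-sound (σ a) c suffix | any-sound _ S synced
...     | x , c≡ | s , s∈S , prefix with isPrefixOfᵇ-sound s (σ a ++ ctx) prefix
...       | t , eq = a , x , c≡ , s , t , s∈S , eq

parses : {m n : ℕ} → (Fin m → List (Fin n)) → (List (Fin n) → Bool) → List (List (Fin n)) → ℕ → Bool
parses σ bad S N = all (λ ctx → Search.everyWord bad ctx (endsWithImage σ S ctx) N) S

synchronises : {n : ℕ} → (List (Fin n) → Bool) → List (List (Fin n)) → ℕ → Bool
synchronises bad S M = Search.everyWord bad [] (λ c → any (_isPrefixOfᵇ c) S) M

module Morphism {A B : Set} (σ : A → List B) where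

  σ* : List A → List B
  σ* = concatMap σ

  σ*-++ : (x y : List A) → σ* (x ++ y) ≡ σ* x ++ σ* y
  σ*-++ = concatMap-++ σ

  σ*-∷ʳ : (y : List A) (a : A) → σ* (y ∷ʳ a) ≡ σ* y ++ σ a
  σ*-∷ʳ y a = trans (σ*-++ y [ a ]) (cong (σ* y ++_) (++-identityʳ (σ a)))

  σ*-≢[] : (∀ a → 1 ≤ length (σ a)) → ∀ q → q ≢ [] → σ* q ≢ []
  σ*-≢[] nonerasing []      q≢[] _  = q≢[] refl
  σ*-≢[] nonerasing (a ∷ q) _    eq with subst (λ x → 1 ≤ length x) (++-conicalˡ (σ a) (σ* q) eq) (nonerasing a)
  ... | ()

  factor-σ* : {u v : List A} → Factor u v → Factor (σ* u) (σ* v)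
  factor-σ* {u} (x , y , refl) = σ* x , σ* y , trans (σ*-++ x (u ++ y)) (cong (σ* x ++_) (σ*-++ u y))

  length-σ*-≤ : {L : ℕ} → (∀ a → length (σ a) ≤ L) → ∀ y → length (σ* y) ≤ L * length y
  length-σ*-≤ short []          = z≤n
  length-σ*-≤ {L} short (a ∷ y) = begin
    length (σ a ++ σ* y)          ≡⟨ length-++ (σ a) ⟩
    length (σ a) + length (σ* y)  ≤⟨ +-mono-≤ (short a) (length-σ*-≤ short y) ⟩
    L + L * length y              ≡⟨ sym (*-suc L (length y)) ⟩
    L * suc (length y)            ∎
    where open ≤-Reasoning

  length-σ*-≥ : {L : ℕ} → (∀ a → L ≤ length (σ a)) → ∀ y → L * length y ≤ length (σ* y)
  length-σ*-≥ {L} long []      = ≤-reflexive (*-zeroʳ L)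
  length-σ*-≥ {L} long (a ∷ y) = begin
    L * suc (length y)            ≡⟨ *-suc L (length y) ⟩
    L + L * length y              ≤⟨ +-mono-≤ (long a) (length-σ*-≥ long y) ⟩
    length (σ a) + length (σ* y)  ≡⟨ sym (length-++ (σ a)) ⟩
    length (σ a ++ σ* y)          ∎
    where open ≤-Reasoning

  avoids-preimage : {badˢ : List A → Bool} {badᵗ : List B → Bool} →
    (∀ v → T (badˢ v) → ¬ Avoids badᵗ (σ* v)) → ∀ y → Avoids badᵗ (σ* y) → Avoids badˢ y
  avoids-preimage bad-image y g v v⊑y bad-v = bad-image v bad-v (avoids-factor (factor-σ* v⊑y) g)

  module _ {K : ℕ} (σ-short : ∀ a → length (σ a) ≤ suc K) where

    image-splitˡ : ∀ y X Z → σ* y ≡ X ++ Z → ∃₂ λ y₁ y₂ → ∃ λ X′ →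
      y ≡ y₁ ++ y₂ × X ≡ σ* y₁ ++ X′ × σ* y₂ ≡ X′ ++ Z × length X′ ≤ K
    image-splitˡ [] X Z eq with ++-conicalˡ X Z (sym eq)
    ... | refl = [] , [] , [] , refl , refl , eq , z≤n
    image-splitˡ (a ∷ y) X Z eq with length (σ a) ≤? length X
    ... | no  σa≰X = [] , a ∷ y , X , refl , refl , eq , ≤-pred (≤-trans (≰⇒> σa≰X) (σ-short a))
    ... | yes σa≤X with ++-split (σ a) (σ* y) X Z eq σa≤X
    ...   | X₂ , refl , eq₂ with image-splitˡ y X₂ Z eq₂
    ...     | y₁ , y₂ , X′ , refl , refl , eq₃ , X′≤ =
              a ∷ y₁ , y₂ , X′ , refl , sym (++-assoc (σ a) (σ* y₁) X′) , eq₃ , X′≤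

    image-splitʳ : ∀ y Z Y → σ* y ≡ Z ++ Y → ∃₂ λ y₁ y₂ → ∃ λ Y′ →
      y ≡ y₁ ++ y₂ × Y ≡ Y′ ++ σ* y₂ × σ* y₁ ≡ Z ++ Y′ × length Y′ ≤ K
    image-splitʳ y       []      Y eq = [] , y , [] , refl , sym eq , refl , z≤n
    image-splitʳ (a ∷ y) (c ∷ Z) Y eq with length (σ a) ≤? length (c ∷ Z)
    ... | yes σa≤Z with ++-split (σ a) (σ* y) (c ∷ Z) Y eq σa≤Z
    ...   | Z₂ , Z≡ , eq₂ with image-splitʳ y Z₂ Y eq₂
    ...     | y₁ , y₂ , Y′ , refl , refl , eq₃ , Y′≤ = a ∷ y₁ , y₂ , Y′ , refl , refl , (begin
              σ a ++ σ* y₁        ≡⟨ cong (σ a ++_) eq₃ ⟩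
              σ a ++ Z₂ ++ Y′     ≡⟨ sym (++-assoc (σ a) Z₂ Y′) ⟩
              (σ a ++ Z₂) ++ Y′   ≡⟨ cong (_++ Y′) (sym Z≡) ⟩
              (c ∷ Z) ++ Y′       ∎) , Y′≤
      where open ≡-Reasoning
    image-splitʳ (a ∷ y) (c ∷ Z) Y eq | no σa≰Z
      with ++-split (c ∷ Z) Y (σ a) (σ* y) (sym eq) (<⇒≤ (≰⇒> σa≰Z))
    ... | Y′ , σa≡ , Y≡ = [ a ] , y , Y′ , refl , Y≡ , trans (++-identityʳ (σ a)) σa≡ , Y′≤
      where
      Y′≤ : length Y′ ≤ K
      Y′≤ = ≤-pred (≤-trans (s≤s (m≤n+m (length Y′) (length Z)))
                   (≤-trans (≤-reflexive (sym (trans (cong length σa≡) (length-++ (c ∷ Z))))) (σ-short a)))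

    image-cover : ∀ y X u Y → σ* y ≡ X ++ u ++ Y → ∃₂ λ y₁ v → ∃ λ y₂ → ∃₂ λ X′ Y′ →
      y ≡ y₁ ++ v ++ y₂ × X ≡ σ* y₁ ++ X′ × Y ≡ Y′ ++ σ* y₂ × σ* v ≡ X′ ++ u ++ Y′ ×
      length X′ ≤ K × length Y′ ≤ K
    image-cover y X u Y eq with image-splitˡ y X (u ++ Y) eq
    ... | y₁ , w , X′ , refl , X≡ , eq₁ , X′≤ with image-splitʳ w (X′ ++ u) Y (trans eq₁ (sym (++-assoc X′ u Y)))
    ...   | v , y₂ , Y′ , refl , Y≡ , eq₂ , Y′≤ =
            y₁ , v , y₂ , X′ , Y′ , refl , X≡ , Y≡ , trans eq₂ (++-assoc X′ u Y′) , X′≤ , Y′≤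

module Desubstitution
  {m n : ℕ} (σ : Fin m → List (Fin n)) {K : ℕ}
  (σ-nonerasing : ∀ a → 1 ≤ length (σ a)) (σ-short : ∀ a → length (σ a) ≤ suc K)
  (badᵗ : List (Fin n) → Bool) (S : List (List (Fin n))) (N M : ℕ)
  (σ-parses : parses σ badᵗ S N ≡ true) (σ-synchronises : synchronises badᵗ S M ≡ true)
  (badˢ : List (Fin m) → Bool) (preimage-avoids : ∀ y → Avoids badᵗ (concatMap σ y) → Avoids badˢ y)
  where

  open Morphism σ public
  open Search badᵗ

  parse-step : ∀ {ctx} → ctx ∈ S → ∀ c → length c ≡ N → Avoids badᵗ (c ++ ctx) →
    ∃₂ λ c′ a → c ≡ c′ ++ σ a × ∃₂ λ s t → s ∈ S × σ a ++ ctx ≡ s ++ t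
  parse-step {ctx} ctx∈S c |c| g with everyWord-sound ctx _ N (all-lookup _ S σ-parses ctx∈S) c |c| g
  ... | d₁ , d₂ , refl , ends with endsWithImage-sound σ S ctx d₂ ends
  ...   | a , x , refl , synced = d₁ ++ x , a , sym (++-assoc d₁ x (σ a)) , synced

  parse : ∀ z {s t} → s ∈ S → Avoids badᵗ (z ++ s ++ t) → ∃₂ λ r y → z ≡ r ++ σ* y × length r < N
  parse z = go z (<-wellFounded (length z))
    where
    go : ∀ z {s t} → Acc _<_ (length z) → s ∈ S → Avoids badᵗ (z ++ s ++ t) →
         ∃₂ λ r y → z ≡ r ++ σ* y × length r < N
    go z {s} {t} (acc rec) s∈S g with length z <? N
    ... | yes short = z , [] , sym (++-identityʳ z) , short
    ... | no  long with splitAtʳ z (≮⇒≥ long)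
    ...   | z₁ , c , refl , |c| with parse-step s∈S c |c| g-c
      where
      g-c : Avoids badᵗ (c ++ s)
      g-c = avoids-factor {u = c ++ s} {z = (z₁ ++ c) ++ s ++ t} (z₁ , t , solve (++-monoid (Fin n))) g
    ...     | c′ , a , refl , s′ , t′ , s′∈S , σa++s≡ with go (z₁ ++ c′) (rec shorter) s′∈S g′
      where
      shorter : length (z₁ ++ c′) < length (z₁ ++ c′ ++ σ a)
      shorter = subst (λ w → length (z₁ ++ c′) < length w) (++-assoc z₁ c′ (σ a))
                      (length-<-++ (z₁ ++ c′) (σ-nonerasing a))
      g′ : Avoids badᵗ ((z₁ ++ c′) ++ s′ ++ t′ ++ t)
      g′ = subst (Avoids badᵗ) (begin
        (z₁ ++ c′ ++ σ a) ++ s ++ t    ≡⟨ solve (++-monoid (Fin n)) ⟩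
        (z₁ ++ c′) ++ (σ a ++ s) ++ t  ≡⟨ cong (λ w → (z₁ ++ c′) ++ w ++ t) σa++s≡ ⟩
        (z₁ ++ c′) ++ (s′ ++ t′) ++ t  ≡⟨ solve (++-monoid (Fin n)) ⟩
        (z₁ ++ c′) ++ s′ ++ t′ ++ t    ∎) g
        where open ≡-Reasoning
    ...       | r , y , z₁++c′≡ , r<N = r , y ∷ʳ a , (begin
                z₁ ++ c′ ++ σ a      ≡⟨ sym (++-assoc z₁ c′ (σ a)) ⟩
                (z₁ ++ c′) ++ σ a    ≡⟨ cong (_++ σ a) z₁++c′≡ ⟩
                (r ++ σ* y) ++ σ a   ≡⟨ ++-assoc r (σ* y) (σ a) ⟩
                r ++ σ* y ++ σ a     ≡⟨ cong (r ++_) (sym (σ*-∷ʳ y a)) ⟩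
                r ++ σ* (y ∷ʳ a)     ∎) , r<N
      where open ≡-Reasoning

  synchronise : ∀ z → Avoids badᵗ z → M ≤ length z →
    ∃₂ λ x s → ∃ λ t → s ∈ S × z ≡ x ++ s ++ t × length (s ++ t) ≤ M
  synchronise z g M≤ with splitAtʳ z M≤
  ... | z₁ , z₂ , refl , |z₂|
    with everyWord-sound [] _ M σ-synchronises z₂ |z₂|
                         (subst (Avoids badᵗ) (sym (++-identityʳ z₂)) (avoids-suffix z₁ z₂ g))
  ...   | d₁ , d₂ , refl , starts with any-sound _ S starts
  ...     | s , s∈S , prefix with isPrefixOfᵇ-sound s d₂ prefix
  ...       | t , refl = z₁ ++ d₁ , s , t , s∈S , sym (++-assoc z₁ d₁ (s ++ t)) ,
                         ≤-trans (m≤n+m _ (length d₁)) (≤-reflexive (trans (sym (length-++ d₁)) |z₂|))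

  desubstitute : ∀ z → Avoids badᵗ z → M ≤ length z →
    ∃₂ λ r y → ∃ λ e → z ≡ r ++ σ* y ++ e × length r < N × length e ≤ M
  desubstitute z g M≤ with synchronise z g M≤
  ... | x , s , t , s∈S , refl , st≤M with parse x s∈S g
  ...   | r , y , refl , r<N = r , y , s ++ t , ++-assoc r (σ* y) (s ++ t) , r<N , st≤M

  margin : ℕ
  margin = N + (K + M)

  liftDepth : ℕ → ℕ
  liftDepth c = suc K * c + margin

  N≤liftDepth : ∀ c → N ≤ liftDepth c
  N≤liftDepth c = ≤-trans (m≤m+n N (K + M)) (m≤n+m margin (suc K * c))

  M≤liftDepth : ∀ c → M ≤ liftDepth c
  M≤liftDepth c = ≤-trans (≤-trans (m≤n+m M K) (m≤n+m (K + M) N)) (m≤n+m margin (suc K * c))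

  preimage-long : ∀ {c} a y e → liftDepth c ≤ length (a ++ σ* y ++ e) → length a + length e ≤ margin → c ≤ length y
  preimage-long {c} a y e long short = *-cancelˡ-≤ (suc K) (+-cancelʳ-≤ margin (suc K * c) (suc K * length y) (begin
    suc K * c + margin                          ≤⟨ long ⟩
    length (a ++ σ* y ++ e)                     ≡⟨ length-++₃ a (σ* y) e ⟩
    length a + (length (σ* y) + length e)       ≤⟨ +-monoʳ-≤ (length a) (+-monoˡ-≤ (length e) (length-σ*-≤ σ-short y)) ⟩
    length a + (suc K * length y + length e)    ≡⟨ rearrange (length a) (suc K * length y) (length e) ⟩
    suc K * length y + (length a + length e)    ≤⟨ +-monoʳ-≤ (suc K * length y) short ⟩
    suc K * length y + margin                   ∎))
    where
    open ≤-Reasoning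
    rearrange : ∀ x y z → x + (y + z) ≡ y + (x + z)
    rearrange = solve-∀

  unavoidable-σ* : ∀ {u} → Unavoidable badˢ u → Unavoidable badᵗ (σ* u)
  unavoidable-σ* {u} (G , occurs) = liftDepth G , occurs-σ*
    where
    occurs-σ* : ∀ z → Avoids badᵗ z → liftDepth G ≤ length z → Factor (σ* u) z
    occurs-σ* z g long with desubstitute z g (≤-trans (M≤liftDepth G) long)
    ... | r , y , e , refl , r<N , e≤M = factor-trans (factor-σ* (occurs y g-y G≤y)) (r , e , refl)
      where
      g-y : Avoids badˢ y
      g-y = preimage-avoids y (avoids-factor (r , e , refl) g)
      G≤y : G ≤ length y
      G≤y = preimage-long r y e long (+-mono-≤ (<⇒≤ r<N) (≤-trans e≤M (m≤n+m M K)))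

  parse-window : ∀ p u s → Avoids badᵗ (p ++ u ++ s) → N ≤ length p → M ≤ length s →
    ∃₂ λ r X → ∃₂ λ y s₁ → ∃ λ e → p ≡ r ++ X × s ≡ s₁ ++ e × σ* y ≡ X ++ u ++ s₁ ×
      Avoids badˢ y × length r < N × length e ≤ M
  parse-window p u s g N≤p M≤s with synchronise s (avoids-suffix u s (avoids-suffix p (u ++ s) g)) M≤s
  ... | s₁ , sy , t , sy∈S , refl , e≤M
    with parse (p ++ u ++ s₁) sy∈S (subst (Avoids badᵗ) (sym (++-assoc₄ p u s₁ (sy ++ t))) g)
  ...   | r , y , window≡ , r<N with ++-split r (σ* y) p (u ++ s₁) (sym window≡) (≤-trans (<⇒≤ r<N) N≤p)
  ...     | X , refl , σy≡ = r , X , y , s₁ , sy ++ t , refl , refl , σy≡ , g-y , r<N , e≤M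
    where
    g-y : Avoids badˢ y
    g-y = preimage-avoids y (avoids-factor (r , sy ++ t , (begin
      (r ++ X) ++ u ++ s₁ ++ sy ++ t    ≡⟨ solve (++-monoid (Fin n)) ⟩
      ((r ++ X) ++ u ++ s₁) ++ sy ++ t  ≡⟨ cong (_++ sy ++ t) window≡ ⟩
      (r ++ σ* y) ++ sy ++ t            ≡⟨ ++-assoc r (σ* y) (sy ++ t) ⟩
      r ++ σ* y ++ sy ++ t              ∎)) g)
      where open ≡-Reasoning

  lift : ∀ c {u} → Extendable badᵗ (liftDepth c) u →
    ∃ λ v → Extendable badˢ c v × Factor u (σ* v) × length (σ* v) ≤ K + (length u + K)
  lift c {u} (extendable p s g p-long s-long)
    with parse-window p u s g (≤-trans (N≤liftDepth c) p-long) (≤-trans (M≤liftDepth c) s-long)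
  ... | r , X , y , s₁ , e , refl , refl , σy≡ , g-y , r<N , e≤M with image-cover σ-short y X u s₁ σy≡
  ...   | y₁ , v , y₂ , X′ , Y′ , refl , refl , refl , σv≡ , X′≤ , Y′≤ =
          v , extendable y₁ y₂ g-y c≤y₁ c≤y₂ , (X′ , Y′ , σv≡) , σv-short
    where
    c≤y₁ : c ≤ length y₁
    c≤y₁ = preimage-long r y₁ X′ p-long (+-mono-≤ (<⇒≤ r<N) (≤-trans X′≤ (m≤m+n K M)))
    c≤y₂ : c ≤ length y₂
    c≤y₂ = preimage-long Y′ y₂ e (≤-trans s-long (≤-reflexive (cong length (++-assoc Y′ (σ* y₂) e))))
             (≤-trans (+-mono-≤ Y′≤ e≤M) (m≤n+m (K + M) N))
    σv-short : length (σ* v) ≤ K + (length u + K)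
    σv-short = ≤-trans (≤-reflexive (trans (cong length σv≡) (length-++₃ X′ u Y′)))
                       (+-mono-≤ X′≤ (+-monoʳ-≤ (length u) Y′≤))

-- Ternary words and the Hall–Thue morphism

-- 212 is forbidden only between two letters: hall (212) = 1021 has no forbidden factor, so
-- preimages of good words could not be shown to avoid 212 itself.
patterns₃ : List (List (Fin 3))
patterns₃ = (t₀ ∷ t₁ ∷ t₀ ∷ []) ∷
  (t₀ ∷ t₂ ∷ t₁ ∷ t₂ ∷ t₀ ∷ []) ∷ (t₀ ∷ t₂ ∷ t₁ ∷ t₂ ∷ t₁ ∷ []) ∷ (t₀ ∷ t₂ ∷ t₁ ∷ t₂ ∷ t₂ ∷ []) ∷
  (t₁ ∷ t₂ ∷ t₁ ∷ t₂ ∷ t₀ ∷ []) ∷ (t₁ ∷ t₂ ∷ t₁ ∷ t₂ ∷ t₁ ∷ []) ∷ (t₁ ∷ t₂ ∷ t₁ ∷ t₂ ∷ t₂ ∷ []) ∷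
  (t₂ ∷ t₂ ∷ t₁ ∷ t₂ ∷ t₀ ∷ []) ∷ (t₂ ∷ t₂ ∷ t₁ ∷ t₂ ∷ t₁ ∷ []) ∷ (t₂ ∷ t₂ ∷ t₁ ∷ t₂ ∷ t₂ ∷ []) ∷ []

forbidden₃ : List (Fin 3) → Bool
forbidden₃ v = squareᵇ v ∨ any (v ==_) patterns₃

module _ {n : ℕ} (σ : Fin 3 → List (Fin n)) (bad : List (Fin n) → Bool) where

  open Morphism σ

  forbidden₃-preimage : (∀ q → q ≢ [] → T (bad (σ* q ++ σ* q))) → all (anyFactor bad ∘ σ*) patterns₃ ≡ true →
                        ∀ y → Avoids bad (σ* y) → Avoids forbidden₃ y
  forbidden₃-preimage squares patterns = avoids-preimage bad-image
    where
    bad-image : ∀ v → T (forbidden₃ v) → ¬ Avoids bad (σ* v)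
    bad-image v h with Equivalence.to T-∨ h
    ... | inj₁ square with squareᵇ-sound v square
    ...   | q , q≢[] , refl = λ g → g _ (factor-refl _) (subst (T ∘ bad) (sym (σ*-++ q q)) (squares q q≢[]))
    bad-image v h | inj₂ listed with any-sound (v ==_) patterns₃ listed
    ...   | p , p∈ , v≡p with ==-sound v p v≡p
    ...     | refl =
      badFactor⇒¬avoids (σ* v) (Equivalence.from T-≡ (all-lookup (anyFactor bad ∘ σ*) patterns₃ patterns p∈))

hall-nonerasing : ∀ a → 1 ≤ length (hallImg a)
hall-nonerasing t₀ = s≤s z≤n
hall-nonerasing t₁ = s≤s z≤n
hall-nonerasing t₂ = s≤s z≤n

hall-short : ∀ a → length (hallImg a) ≤ 3
hall-short t₀ = ≤-refl
hall-short t₁ = m≤m+n 2 1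
hall-short t₂ = m≤m+n 1 2

sync₃ : List (List (Fin 3))
sync₃ = (t₀ ∷ t₁ ∷ []) ∷ (t₀ ∷ t₂ ∷ []) ∷ (t₁ ∷ t₀ ∷ []) ∷ []

-- Checks are stated as b ≡ true rather than T b: checking a term against T b makes Agda
-- reduce b, which would rerun the whole computation at every use.
hall-parses : parses hallImg forbidden₃ sync₃ 4 ≡ true
hall-parses = refl

hall-synchronises : synchronises forbidden₃ sync₃ 5 ≡ true
hall-synchronises = refl

hall-patterns : all (anyFactor forbidden₃ ∘ hall) patterns₃ ≡ true
hall-patterns = refl

hall-avoids-preimage : ∀ y → Avoids forbidden₃ (hall y) → Avoids forbidden₃ y
hall-avoids-preimage = forbidden₃-preimage hallImg forbidden₃ squares hall-patterns
  where
  squares : ∀ q → q ≢ [] → T (forbidden₃ (hall q ++ hall q))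
  squares q q≢[] =
    Equivalence.from T-∨ (inj₁ (squareᵇ-complete (hall q) (Morphism.σ*-≢[] hallImg hall-nonerasing q q≢[])))

module Hall = Desubstitution hallImg hall-nonerasing hall-short forbidden₃ sync₃ 4 5
                            hall-parses hall-synchronises forbidden₃ hall-avoids-preimage

zero-unavoidable : Unavoidable forbidden₃ (t₀ ∷ [])
zero-unavoidable = 5 , occurs
  where
  zero∈sync : ∀ {s} → s ∈ sync₃ → Factor (t₀ ∷ []) s
  zero∈sync (here refl)                 = [] , t₁ ∷ [] , refl
  zero∈sync (there (here refl))         = [] , t₂ ∷ [] , refl
  zero∈sync (there (there (here refl))) = t₁ ∷ [] , [] , refl
  occurs : ∀ z → Avoids forbidden₃ z → 5 ≤ length z → Factor (t₀ ∷ []) z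
  occurs z g long with Hall.synchronise z g long
  ... | x , s , t , s∈S , refl , _ = factor-trans (zero∈sync s∈S) (x , t , refl)

hallIter-unavoidable : ∀ k → Unavoidable forbidden₃ (hallIter k)
hallIter-unavoidable zero    = zero-unavoidable
hallIter-unavoidable (suc k) = Hall.unavoidable-σ* (hallIter-unavoidable k)

pair-length : ∀ a b → Avoids forbidden₃ (a ∷ b ∷ []) → 3 ≤ length (hallImg a) + length (hallImg b)
pair-length t₀ b  _ = s≤s (s≤s (s≤s z≤n))
pair-length t₁ t₀ _ = s≤s (s≤s (s≤s z≤n))
pair-length t₁ t₁ _ = s≤s (s≤s (s≤s z≤n))
pair-length t₁ t₂ _ = s≤s (s≤s (s≤s z≤n))
pair-length t₂ t₀ _ = s≤s (s≤s (s≤s z≤n))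
pair-length t₂ t₁ _ = s≤s (s≤s (s≤s z≤n))
pair-length t₂ t₂ g = ⊥-elim (badFactor⇒¬avoids (t₂ ∷ t₂ ∷ []) _ g)

hall-length : ∀ v → Avoids forbidden₃ v → 3 * length v ≤ 2 * length (hall v) + 2
hall-length []          _ = z≤n
hall-length (t₀ ∷ [])   _ = s≤s (s≤s (s≤s z≤n))
hall-length (t₁ ∷ [])   _ = s≤s (s≤s (s≤s z≤n))
hall-length (t₂ ∷ [])   _ = s≤s (s≤s (s≤s z≤n))
hall-length (a ∷ b ∷ v) g = begin
  3 * (2 + length v)                             ≡⟨ expand₁ (length v) ⟩
  2 * 3 + 3 * length v                           ≤⟨ +-mono-≤ (*-monoʳ-≤ 2 (pair-length a b ab-avoids))
                                                             (hall-length v v-avoids) ⟩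
  2 * (|a| + |b|) + (2 * length (hall v) + 2)    ≡⟨ expand₂ |a| |b| (length (hall v)) ⟩
  2 * (|a| + (|b| + length (hall v))) + 2        ≡⟨ cong (λ ℓ → 2 * ℓ + 2) (sym |hall-abv|) ⟩
  2 * length (hall (a ∷ b ∷ v)) + 2              ∎
  where
  open ≤-Reasoning
  |a| = length (hallImg a)
  |b| = length (hallImg b)
  ab-avoids : Avoids forbidden₃ (a ∷ b ∷ [])
  ab-avoids = avoids-prefix (a ∷ b ∷ []) v g
  v-avoids : Avoids forbidden₃ v
  v-avoids = avoids-suffix (a ∷ b ∷ []) v g
  |hall-abv| : length (hall (a ∷ b ∷ v)) ≡ |a| + (|b| + length (hall v))
  |hall-abv| = length-++₃ (hallImg a) (hallImg b) (hall v)
  expand₁ : ∀ x → 3 * (2 + x) ≡ 2 * 3 + 3 * x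
  expand₁ = solve-∀
  expand₂ : ∀ x y z → 2 * (x + y) + (2 * z + 2) ≡ 2 * (x + (y + z)) + 2
  expand₂ = solve-∀

preimage-shorter : ∀ {v h u} → 3 * v ≤ 2 * h + 2 → h ≤ 2 + (u + 2) → 10 < u → v < u
preimage-shorter {v} {h} {u} 3v≤ h≤ 10<u = *-cancelˡ-< 3 v u (begin-strict
  3 * v                    ≤⟨ 3v≤ ⟩
  2 * h + 2                ≤⟨ +-monoˡ-≤ 2 (*-monoʳ-≤ 2 h≤) ⟩
  2 * (2 + (u + 2)) + 2    ≡⟨ expand u ⟩
  2 * u + 10               <⟨ +-monoʳ-< (2 * u) 10<u ⟩
  2 * u + u                ≡⟨ collect u ⟩
  3 * u                    ∎)
  where
  open ≤-Reasoning
  expand : ∀ x → 2 * (2 + (x + 2)) + 2 ≡ 2 * x + 10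
  expand = solve-∀
  collect : ∀ x → 2 * x + x ≡ 3 * x
  collect = solve-∀

middleOccurs : List (Fin 3) → Bool
middleOccurs d = occursᵇ (take 10 (drop 4 d)) (hallIter 6)

middles-occur : Search.everyWordOfLength forbidden₃ middleOccurs 18 ≡ true
middles-occur = refl

short-extendable⇒hallIter : ∀ u → length u ≤ 10 → Extendable forbidden₃ 14 u → Factor u (hallIter 6)
short-extendable⇒hallIter u short (extendable p s g p-long s-long)
  with splitAtʳ p (≤-trans (m≤n+m 4 10) p-long) | splitAtˡ s (≤-trans (m∸n≤m 14 (length u)) s-long)
... | p₁ , p₂ , refl , |p₂| | s₁ , s₂ , refl , |s₁| =
  factor-trans ([] , take (10 ∸ length u) s₁ , middle≡) (occursᵇ-sound _ (hallIter 6) found)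
  where
  d = p₂ ++ u ++ s₁
  g-d : Avoids forbidden₃ d
  g-d = avoids-factor {u = d} {z = (p₁ ++ p₂) ++ u ++ s₁ ++ s₂} (p₁ , s₂ , solve (++-monoid (Fin 3))) g
  |d| : length d ≡ 18
  |d| = begin
    length (p₂ ++ u ++ s₁)               ≡⟨ length-++₃ p₂ u s₁ ⟩
    length p₂ + (length u + length s₁)   ≡⟨ cong₂ _+_ |p₂| (cong (length u +_) |s₁|) ⟩
    4 + (length u + (14 ∸ length u))     ≡⟨ cong (4 +_) (m+[n∸m]≡n (≤-trans short (m≤m+n 10 4))) ⟩
    18                                   ∎
    where open ≡-Reasoning
  found : T (middleOccurs d)
  found = Search.everyWordOfLength-sound forbidden₃ middleOccurs 18 middles-occur d |d| g-d
  middle≡ : take 10 (drop 4 d) ≡ u ++ take (10 ∸ length u) s₁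
  middle≡ = begin
    take 10 (drop 4 d)                  ≡⟨ cong (λ j → take 10 (drop j d)) (sym |p₂|) ⟩
    take 10 (drop (length p₂) d)        ≡⟨ cong (take 10) (drop-length-++ p₂ (u ++ s₁)) ⟩
    take 10 (u ++ s₁)                   ≡⟨ take-++ 10 u s₁ short ⟩
    u ++ take (10 ∸ length u) s₁        ∎
    where open ≡-Reasoning

-- Opaque: unfolding hallDepth (k + j) makes the type checker expand an arithmetic
-- expression of size exponential in k.
opaque
  hallDepth : ℕ → ℕ
  hallDepth zero    = 14
  hallDepth (suc j) = Hall.liftDepth (hallDepth j)

  hallDepth-suc : ∀ j → hallDepth (suc j) ≡ Hall.liftDepth (hallDepth j)
  hallDepth-suc j = refl

  14≤hallDepth : ∀ j → 14 ≤ hallDepth j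
  14≤hallDepth zero    = ≤-refl
  14≤hallDepth (suc j) =
    ≤-trans (14≤hallDepth j) (≤-trans (m≤m+n (hallDepth j) _) (m≤m+n (3 * hallDepth j) Hall.margin))

extendable⇒hallIter : ∀ j u → length u ≤ 10 + j → Extendable forbidden₃ (hallDepth j) u → ∃ λ k → Factor u (hallIter k)
extendable⇒hallIter j u |u|≤ ext with length u ≤? 10
... | yes short = 6 , short-extendable⇒hallIter u short (extendable-≤ (14≤hallDepth j) ext)
extendable⇒hallIter zero    u |u|≤ ext | no long = ⊥-elim (long |u|≤)
extendable⇒hallIter (suc j) u |u|≤ ext | no long =
  lifted (Hall.lift (hallDepth j) (subst (λ c → Extendable forbidden₃ c u) (hallDepth-suc j) ext))
  where
  -- A helper rather than a with: abstracting over Hall.lift … would make Agda normalise it.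
  lifted : (∃ λ v → Extendable forbidden₃ (hallDepth j) v × Factor u (hall v) ×
                    length (hall v) ≤ 2 + (length u + 2)) →
           ∃ λ k → Factor u (hallIter k)
  lifted (v , ext-v , u⊑hall-v , |hall-v|) =
    let k , v⊑ = extendable⇒hallIter j v |v|≤ ext-v in suc k , factor-trans u⊑hall-v (Hall.factor-σ* v⊑)
    where
    open Extendable ext-v
    |v|≤ : length v ≤ 10 + j
    |v|≤ = ≤-pred (≤-trans (preimage-shorter (hall-length v v-avoids) |hall-v| (≰⇒> long)) |u|≤)
      where
      v-avoids : Avoids forbidden₃ v
      v-avoids = avoids-factor (left , right , refl) avoids

-- Binary words and g₄

allowedSquares : List (List (Fin 2))
allowedSquares = (O ∷ O ∷ []) ∷ (I ∷ I ∷ []) ∷ (O ∷ O ∷ I ∷ O ∷ O ∷ I ∷ []) ∷ (I ∷ I ∷ O ∷ I ∷ I ∷ O ∷ []) ∷ []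

allowedᵇ : List (Fin 2) → Bool
allowedᵇ u = any (u ==_) allowedSquares

forbidden₂ : List (Fin 2) → Bool
forbidden₂ u = squareᵇ u ∧ not (allowedᵇ u)

Allowed⇒allowedᵇ : ∀ {u} → Allowed u → T (allowedᵇ u)
Allowed⇒allowedᵇ (inj₁ refl)               = _
Allowed⇒allowedᵇ (inj₂ (inj₁ refl))        = _
Allowed⇒allowedᵇ (inj₂ (inj₂ (inj₁ refl))) = _
Allowed⇒allowedᵇ (inj₂ (inj₂ (inj₂ refl))) = _

allowedᵇ⇒length≤6 : ∀ u → T (allowedᵇ u) → length u ≤ 6
allowedᵇ⇒length≤6 u h with any-sound (u ==_) allowedSquares h
... | s , s∈ , u≡s with ==-sound u s u≡s
...   | refl = listed-short s∈
  where
  listed-short : ∀ {s} → s ∈ allowedSquares → length s ≤ 6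
  listed-short (here refl)                         = s≤s (s≤s z≤n)
  listed-short (there (here refl))                 = s≤s (s≤s z≤n)
  listed-short (there (there (here refl)))         = ≤-refl
  listed-short (there (there (there (here refl)))) = ≤-refl

forbidden₂-sound : ∀ u → T (forbidden₂ u) → IsSquare u × ¬ Allowed u
forbidden₂-sound u h with Equivalence.to T-∧ h
... | square , not-allowed = squareᵇ-sound u square , λ allowed →
        subst T (Equivalence.to T-not-≡ not-allowed) (Allowed⇒allowedᵇ allowed)

long-square-forbidden₂ : ∀ w → 7 ≤ length (w ++ w) → T (forbidden₂ (w ++ w))
long-square-forbidden₂ w long with allowedᵇ (w ++ w) | allowedᵇ⇒length≤6 (w ++ w)
... | true  | short = ⊥-elim (<⇒≱ long (short _))
... | false | _     = Equivalence.from T-∧ (squareᵇ-complete w w≢[] , _)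
  where
  w≢[] : w ≢ []
  w≢[] refl = <⇒≱ long z≤n

g₄-long : ∀ a → 5 ≤ length (g₄Img a)
g₄-long t₀ = m≤m+n 5 12
g₄-long t₁ = m≤m+n 5 7
g₄-long t₂ = ≤-refl

g₄-nonerasing : ∀ a → 1 ≤ length (g₄Img a)
g₄-nonerasing a = ≤-trans (s≤s z≤n) (g₄-long a)

g₄-short : ∀ a → length (g₄Img a) ≤ 17
g₄-short t₀ = ≤-refl
g₄-short t₁ = m≤m+n 12 5
g₄-short t₂ = m≤m+n 5 12

sync₂ : List (List (Fin 2))
sync₂ = (O ∷ O ∷ O ∷ I ∷ O ∷ O ∷ I ∷ I ∷ O ∷ O ∷ O ∷ I ∷ I ∷ []) ∷
        (O ∷ O ∷ O ∷ I ∷ O ∷ O ∷ I ∷ I ∷ I ∷ O ∷ I ∷ I ∷ O ∷ []) ∷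
        (O ∷ O ∷ I ∷ I ∷ I ∷ O ∷ O ∷ O ∷ I ∷ O ∷ O ∷ I ∷ I ∷ []) ∷ []

g₄-parses : parses g₄Img forbidden₂ sync₂ 17 ≡ true
g₄-parses = refl

g₄-synchronises : synchronises forbidden₂ sync₂ 35 ≡ true
g₄-synchronises = refl

g₄-patterns : all (anyFactor forbidden₂ ∘ g₄) patterns₃ ≡ true
g₄-patterns = refl

g₄-avoids-preimage : ∀ y → Avoids forbidden₂ (g₄ y) → Avoids forbidden₃ y
g₄-avoids-preimage = forbidden₃-preimage g₄Img forbidden₂ squares g₄-patterns
  where
  squares : ∀ q → q ≢ [] → T (forbidden₂ (g₄ q ++ g₄ q))
  squares []      q≢[] = ⊥-elim (q≢[] refl)
  squares (a ∷ q) _    = long-square-forbidden₂ (g₄ (a ∷ q)) (begin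
    7                                                    ≤⟨ m≤m+n 7 3 ⟩
    5 + 5                                                ≤⟨ +-mono-≤ (g₄-long a) (g₄-long a) ⟩
    length (g₄Img a) + length (g₄Img a)                  ≤⟨ +-mono-≤ (length-++-≤ˡ (g₄Img a)) (length-++-≤ˡ (g₄Img a)) ⟩
    length (g₄Img a ++ g₄ q) + length (g₄Img a ++ g₄ q)  ≡⟨ sym (length-++ (g₄ (a ∷ q))) ⟩
    length (g₄ (a ∷ q) ++ g₄ (a ∷ q))                    ∎)
    where open ≤-Reasoning

module G₄ = Desubstitution g₄Img g₄-nonerasing g₄-short forbidden₂ sync₂ 17 35
                          g₄-parses g₄-synchronises forbidden₃ g₄-avoids-preimage

g₄-unavoidable : ∀ k → Unavoidable forbidden₂ (g₄ (hallIter k))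
g₄-unavoidable k = G₄.unavoidable-σ* (hallIter-unavoidable k)

g₄Depth : ℕ → ℕ
g₄Depth ℓ = G₄.liftDepth (hallDepth (22 + ℓ))

extendable⇒g₄-hallIter : ∀ u → Extendable forbidden₂ (g₄Depth (length u)) u → ∃ λ k → Factor u (g₄ (hallIter k))
extendable⇒g₄-hallIter u ext = lifted (G₄.lift (hallDepth (22 + length u)) ext)
  where
  lifted : (∃ λ v → Extendable forbidden₃ (hallDepth (22 + length u)) v × Factor u (g₄ v) ×
                    length (g₄ v) ≤ 16 + (length u + 16)) →
           ∃ λ k → Factor u (g₄ (hallIter k))
  lifted (v , ext-v , u⊑g₄v , |g₄v|) =
    let k , v⊑ = extendable⇒hallIter (22 + length u) v |v|≤ ext-v in k , factor-trans u⊑g₄v (G₄.factor-σ* v⊑)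
    where
    |v|≤ : length v ≤ 32 + length u
    |v|≤ = begin
      length v                ≡⟨ sym (*-identityˡ (length v)) ⟩
      1 * length v            ≤⟨ G₄.length-σ*-≥ g₄-nonerasing v ⟩
      length (g₄ v)           ≤⟨ |g₄v| ⟩
      16 + (length u + 16)    ≡⟨ rearrange (length u) ⟩
      32 + length u           ∎
      where
      open ≤-Reasoning
      rearrange : ∀ x → 16 + (x + 16) ≡ 32 + x
      rearrange = solve-∀

-- Factors of g₄(b₃) and of bi-infinite words

hallIter-step : ∀ k → ∃ λ t → hallIter (suc k) ≡ hallIter k ++ t
hallIter-step zero    = t₁ ∷ t₂ ∷ [] , refl
hallIter-step (suc k) = let t , e = hallIter-step k in hall t , trans (cong hall e) (Hall.σ*-++ (hallIter k) t)

hallIter-prefix : ∀ d k → ∃ λ t → hallIter (d + k) ≡ hallIter k ++ t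
hallIter-prefix zero    k = [] , sym (++-identityʳ (hallIter k))
hallIter-prefix (suc d) k =
  let t , e = hallIter-prefix d k ; t′ , e′ = hallIter-step (d + k)
  in t ++ t′ , trans e′ (trans (cong (_++ t′) e) (++-assoc (hallIter k) t t′))

FactorOfG₄b₃⇒g₄-hallIter : ∀ {u} → FactorOfG₄b₃ u → ∃ λ k → Factor u (g₄ (hallIter k))
FactorOfG₄b₃⇒g₄-hallIter (n , u⊑) =
  n , factor-trans u⊑ (G₄.factor-σ* ([] , drop n (hallIter n) , sym (take++drop≡id n (hallIter n))))

g₄-hallIter⇒FactorOfG₄b₃ : ∀ {u} → (∃ λ k → Factor u (g₄ (hallIter k))) → FactorOfG₄b₃ u
g₄-hallIter⇒FactorOfG₄b₃ (k , u⊑) = n , factor-trans u⊑ (G₄.factor-σ* prefix)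
  where
  -- b₃-prefix n is cut from hallIter n, which extends hallIter k, and n ≥ length (hallIter k).
  n = length (hallIter k) + k
  prefix : Factor (hallIter k) (b₃-prefix n)
  prefix = let t , e = hallIter-prefix (length (hallIter k)) k in
    [] , take (n ∸ length (hallIter k)) t ,
    trans (cong (take n) e) (take-++ n (hallIter k) t (m≤m+n (length (hallIter k)) k))

module _ (w : BiWord) where

  length-slice : ∀ i n → length (slice w i n) ≡ n
  length-slice i zero    = refl
  length-slice i (suc n) = cong suc (length-slice (i ℤ.+ ℤ.+ 1) n)

  slice-++ : ∀ i a b → slice w i (a + b) ≡ slice w i a ++ slice w (i ℤ.+ ℤ.+ a) b
  slice-++ i zero    b = cong (λ j → slice w j b) (sym (ℤₚ.+-identityʳ i))
  slice-++ i (suc a) b = cong (w i ∷_) (trans (slice-++ (i ℤ.+ ℤ.+ 1) a b)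
    (cong (λ j → slice w (i ℤ.+ ℤ.+ 1) a ++ slice w j b) (ℤₚ.+-assoc i (ℤ.+ 1) (ℤ.+ a))))

  slice-prefix : ∀ i n v {y} → slice w i n ≡ v ++ y → slice w i (length v) ≡ v
  slice-prefix i n       []      eq = refl
  slice-prefix i (suc n) (a ∷ v) eq with ∷-injective eq
  ... | refl , eq′ = cong (w i ∷_) (slice-prefix (i ℤ.+ ℤ.+ 1) n v eq′)

  slice-suffix : ∀ i n x {z} → slice w i n ≡ x ++ z → ∃ λ m → slice w (i ℤ.+ ℤ.+ length x) m ≡ z
  slice-suffix i n       []      eq = n , trans (cong (λ j → slice w j n) (ℤₚ.+-identityʳ i)) eq
  slice-suffix i (suc n) (a ∷ x) eq =
    let m , eq′ = slice-suffix (i ℤ.+ ℤ.+ 1) n x (∷-injectiveʳ eq)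
    in m , trans (cong (λ j → slice w j m) (sym (ℤₚ.+-assoc i (ℤ.+ 1) (ℤ.+ length x)))) eq′

  slice-factor⇒FactorOf : ∀ {i n v} → Factor v (slice w i n) → FactorOf w v
  slice-factor⇒FactorOf {i} {n} {v} (x , y , eq) =
    let m , eq′ = slice-suffix i n x eq in i ℤ.+ ℤ.+ length x , slice-prefix _ m v eq′

  module _ (squares-allowed : ∀ u → FactorOf w u → IsSquare u → Allowed u) where

    slice-avoids : ∀ i n → Avoids forbidden₂ (slice w i n)
    slice-avoids i n v v⊑ forbidden =
      let square , ¬allowed = forbidden₂-sound v forbidden
      in ¬allowed (squares-allowed v (slice-factor⇒FactorOf v⊑) square)

    FactorOf⇒extendable : ∀ {u} c → FactorOf w u → Extendable forbidden₂ c u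
    FactorOf⇒extendable {u} c (i , u≡) =
      extendable (slice w j c) (slice w k c)
                 (subst (Avoids forbidden₂) window (slice-avoids j (c + (length u + c))))
                 (≤-reflexive (sym (length-slice j c))) (≤-reflexive (sym (length-slice k c)))
      where
      j = i ℤ.- ℤ.+ c
      k = i ℤ.+ ℤ.+ length u
      j+c≡i : j ℤ.+ ℤ.+ c ≡ i
      j+c≡i = trans (ℤₚ.+-assoc i (ℤ.- ℤ.+ c) (ℤ.+ c))
                    (trans (cong (λ l → i ℤ.+ l) (ℤₚ.+-inverseˡ (ℤ.+ c))) (ℤₚ.+-identityʳ i))
      window : slice w j (c + (length u + c)) ≡ slice w j c ++ u ++ slice w k c
      window = begin
        slice w j (c + (length u + c))                          ≡⟨ slice-++ j c (length u + c) ⟩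
        slice w j c ++ slice w (j ℤ.+ ℤ.+ c) (length u + c)     ≡⟨ cong (λ l → slice w j c ++ slice w l (length u + c)) j+c≡i ⟩
        slice w j c ++ slice w i (length u + c)                 ≡⟨ cong (slice w j c ++_) (slice-++ i (length u) c) ⟩
        slice w j c ++ slice w i (length u) ++ slice w k c      ≡⟨ cong (λ v → slice w j c ++ v ++ slice w k c) u≡ ⟩
        slice w j c ++ u ++ slice w k c                         ∎
        where open ≡-Reasoning

theorem2 : (w : BiWord)
    → (∀ u → FactorOf w u → IsSquare u → Allowed u)
    → (∀ u → (FactorOf w u → FactorOfG₄b₃ u) × (FactorOfG₄b₃ u → FactorOf w u))
theorem2 w squares-allowed u = factor⇒g₄b₃ , g₄b₃⇒factor
  where
  factor⇒g₄b₃ : FactorOf w u → FactorOfG₄b₃ u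
  factor⇒g₄b₃ u∈w = g₄-hallIter⇒FactorOfG₄b₃
    (extendable⇒g₄-hallIter u (FactorOf⇒extendable w squares-allowed (g₄Depth (length u)) u∈w))
  g₄b₃⇒factor : FactorOfG₄b₃ u → FactorOf w u
  g₄b₃⇒factor u∈g₄b₃ =
    let k , u⊑ = FactorOfG₄b₃⇒g₄-hallIter u∈g₄b₃
        G , occurs = g₄-unavoidable k
        prefix = slice w (ℤ.+ 0) G
    in slice-factor⇒FactorOf w (factor-trans u⊑ (occurs prefix (slice-avoids w squares-allowed (ℤ.+ 0) G)
                                                          (≤-reflexive (sym (length-slice w (ℤ.+ 0) G)))))
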